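{- Let $n_1,m_1,m_2,n_2$ be positive integers and let $\Omega$ be the graph whose vertex set is the disjoint union of sets $B_1,A_1,A_2,B_2$ with $|B_i|=n_i$, $|A_i|=m_i$, where $B_1,B_2$ are cliques, $A_1,A_2$ are independent sets, consecutive sets in the order $B_1,A_1,A_2,B_2$ are completely joined, and there are no other edges. Let $\mathbf d$ assign $1$ to every vertex of $B_1\cup B_2$ and $2$ to every vertex of $A_1\cup A_2$. Then the Smith normal form of $D_X(\Omega)|_{X=\mathbf d}$ is $\operatorname{diag}(1,1,3,3,0,\dots,0)$, and $\Omega\in\Lambda_2^{\mathbb Z}$.
   Context: All graphs are finite, simple, connected. For a connected graph $G$ with vertex set $V$, let $X=\{x_u:u\in V\}$ be indeterminates, $D(G)$ the distance matrix (entries $d_G(u,v)$), and $D_X(G)=\operatorname{diag}(X)+D(G)$; $D_X(G)|_{X=\mathbf d}$ is the integer matrix obtained by substituting $x_u=d_u$. The Smith normal form of an integer matrix of rank $r$ is the unique diagonal matrix $\operatorname{diag}(f_1,\dots,f_r,0,\dots,0)$ equivalent to it over $\mathbb Z$ with $f_i>0$, $f_i\mid f_{i+1}$. For a commutative ring $\mathfrak R$ with unity, the $i$-th distance ideal $I_i^{\mathfrak R}(G)$ is the ideal of $\mathfrak R[X]$ generated by all $i\times i$ minors of $D_X(G)$; an ideal is trivial if it equals $\mathfrak R[X]$; $\Lambda_k^{\mathfrak R}$ is the family of connected graphs with at most $k$ trivial distance ideals over $\mathfrak R[X]$. -}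

module Defs where

open import Data.Nat as ℕ using (ℕ; zero; suc; _≤_)
open import Data.Integer as ℤ using (ℤ; +_; 0ℤ; 1ℤ)
open import Data.Integer.Divisibility using (_∣_)
open import Data.Fin as Fin using (Fin; toℕ; splitAt; punchIn)
open import Data.Fin.Properties using () renaming (_≟_ to _≟F_)
open import Data.Vec using (Vec; tabulate; replicate; zipWith)
open import Data.Vec.Properties using (≡-dec)
open import Data.List using (List; []; _∷_; _++_; map; concatMap; foldr)
open import Data.Product using (Σ; _×_; _,_)
open import Data.Sum using (_⊎_; inj₁; inj₂)
open import Relation.Nullary using (¬_; yes; no)
open import Relation.Binary.PropositionalEquality using (_≡_; _≢_)
open import Function.Definitions using (Injective)

data Walk {N : ℕ} (Adj : Fin N → Fin N → Set) (u : Fin N) : Fin N → ℕ → Set where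
  here : Walk Adj u u 0
  step : ∀ {w v k} → Walk Adj u w k → Adj w v → Walk Adj u v (suc k)

IsDist : {N : ℕ} → (Fin N → Fin N → Set) → Fin N → Fin N → ℕ → Set
IsDist Adj u v k = Walk Adj u v k × (∀ l → Walk Adj u v l → k ≤ l)

sumFin : {n : ℕ} → (Fin n → ℤ) → ℤ
sumFin {zero}  f = 0ℤ
sumFin {suc n} f = f Fin.zero ℤ.+ sumFin (λ i → f (Fin.suc i))

sign : {n : ℕ} → Fin n → ℤ
sign i with toℕ i ℕ.% 2
... | zero = 1ℤ
... | suc _ = ℤ.- 1ℤ

Mat : ℕ → ℕ → Set
Mat m n = Fin m → Fin n → ℤ

_⊗_ : {m n p : ℕ} → Mat m n → Mat n p → Mat m p
(A ⊗ B) i j = sumFin (λ k → A i k ℤ.* B k j)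

idMat : {n : ℕ} → Mat n n
idMat i j with i ≟F j
... | yes _ = 1ℤ
... | no _  = 0ℤ

diagMat : {n : ℕ} → (Fin n → ℤ) → Mat n n
diagMat f i j with i ≟F j
... | yes _ = f i
... | no _  = 0ℤ

Unimodular : {n : ℕ} → Mat n n → Set
Unimodular {n} P = Σ (Mat n n) λ Q → (∀ i j → (P ⊗ Q) i j ≡ idMat i j) × (∀ i j → (Q ⊗ P) i j ≡ idMat i j)

EquivZ : {n : ℕ} → Mat n n → Mat n n → Set
EquivZ {n} M S = Σ (Mat n n) λ P → Σ (Mat n n) λ Q →
  Unimodular P × Unimodular Q × (∀ i j → ((P ⊗ M) ⊗ Q) i j ≡ S i j)

-- f describes diag(f_1,...,f_r,0,...,0) with f_i > 0 and f_i ∣ f_{i+1}.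
IsSmithDiagonal : {n : ℕ} → (Fin n → ℤ) → Set
IsSmithDiagonal {n} f = Σ ℕ λ r → r ≤ n ×
  (∀ i → toℕ i ℕ.< r → 0ℤ ℤ.< f i) ×
  (∀ i → r ≤ toℕ i → f i ≡ 0ℤ) ×
  (∀ (i j : Fin n) → suc (toℕ i) ≡ toℕ j → suc (toℕ i) ℕ.< r → f i ∣ f j)

SmithNormalForm : {n : ℕ} → Mat n n → (Fin n → ℤ) → Set
SmithNormalForm M f = IsSmithDiagonal f × EquivZ M (diagMat f)

-- Polynomials in ℤ[x_0,...,x_{N-1}] as finite formal sums of terms,
-- with equality = equality of all coefficients.

Monomial : ℕ → Set
Monomial N = Vec ℕ N

Poly : ℕ → Set
Poly N = List (ℤ × Monomial N)

coeff : {N : ℕ} → Poly N → Monomial N → ℤ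
coeff [] e = 0ℤ
coeff ((c , α) ∷ p) e with ≡-dec ℕ._≟_ α e
... | yes _ = c ℤ.+ coeff p e
... | no _  = coeff p e

_≈P_ : {N : ℕ} → Poly N → Poly N → Set
p ≈P q = ∀ e → coeff p e ≡ coeff q e

0P : {N : ℕ} → Poly N
0P = []

constP : {N : ℕ} → ℤ → Poly N
constP c = (c , replicate _ 0) ∷ []

1P : {N : ℕ} → Poly N
1P = constP 1ℤ

varP : {N : ℕ} → Fin N → Poly N
varP i = (1ℤ , tabulate (λ j → unit j)) ∷ []
  where
  unit : Fin _ → ℕ
  unit j with i ≟F j
  ... | yes _ = 1
  ... | no _  = 0

_+P_ : {N : ℕ} → Poly N → Poly N → Poly N
p +P q = p ++ q

_*P_ : {N : ℕ} → Poly N → Poly N → Poly N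
p *P q = concatMap (λ { (a , α) → map (λ { (b , β) → (a ℤ.* b , zipWith ℕ._+_ α β) }) q }) p

scaleP : {N : ℕ} → ℤ → Poly N → Poly N
scaleP c p = constP c *P p

sumFinP : {N n : ℕ} → (Fin n → Poly N) → Poly N
sumFinP {n = zero}  f = 0P
sumFinP {n = suc n} f = f Fin.zero +P sumFinP (λ i → f (Fin.suc i))

detP : {N n : ℕ} → (Fin n → Fin n → Poly N) → Poly N
detP {n = zero}  A = 1P
detP {n = suc n} A =
  sumFinP (λ j → scaleP (sign j) (A Fin.zero j *P detP (λ a b → A (Fin.suc a) (punchIn j b))))

-- D_X(G) = diag(X) + D(G), with x_u the variable varP u.
DX : {N : ℕ} → (Fin N → Fin N → ℕ) → Fin N → Fin N → Poly N
DX dist u v with u ≟F v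
... | yes _ = varP u +P constP (+ dist u v)
... | no _  = constP (+ dist u v)

DXeval : {N : ℕ} → (Fin N → ℤ) → (Fin N → Fin N → ℕ) → Mat N N
DXeval x dist u v with u ≟F v
... | yes _ = x u ℤ.+ + dist u v
... | no _  = + dist u v

record Minor (N i : ℕ) : Set where
  field
    rows    : Fin i → Fin N
    cols    : Fin i → Fin N
    rowsInc : ∀ {a b} → a Fin.< b → rows a Fin.< rows b
    colsInc : ∀ {a b} → a Fin.< b → cols a Fin.< cols b

minorP : {N i : ℕ} → (Fin N → Fin N → Poly N) → Minor N i → Poly N
minorP M μ = detP (λ a b → M (Minor.rows μ a) (Minor.cols μ b))

sumListP : {N : ℕ} → List (Poly N) → Poly N
sumListP = foldr _+P_ 0P

-- The ideal of ℤ[X] generated by the i×i minors of M equals ℤ[X],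
-- i.e. 1 is a ℤ[X]-linear combination of i×i minors.
TrivialIdeal : {N : ℕ} → (Fin N → Fin N → Poly N) → ℕ → Set
TrivialIdeal {N} M i = Σ (List (Poly N × Minor N i)) λ L →
  sumListP (map (λ { (c , μ) → c *P minorP M μ }) L) ≈P 1P

-- G (given by its distance function) has at most k trivial distance ideals
-- I_i^ℤ(G), i ≥ 1: there are no k+1 distinct indices i with I_i trivial.
InLambdaZ : {N : ℕ} → ℕ → (Fin N → Fin N → ℕ) → Set
InLambdaZ k dist = ¬ (Σ (Fin (suc k) → ℕ) λ f → Injective _≡_ _≡_ f ×
  (∀ j → 1 ≤ f j × TrivialIdeal (DX dist) (f j)))

data Block : Set where
  B₁ A₁ A₂ B₂ : Block

ΩN : ℕ → ℕ → ℕ → ℕ → ℕ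
ΩN n₁ m₁ m₂ n₂ = n₁ ℕ.+ (m₁ ℕ.+ (m₂ ℕ.+ n₂))

block : (n₁ m₁ m₂ n₂ : ℕ) → Fin (ΩN n₁ m₁ m₂ n₂) → Block
block n₁ m₁ m₂ n₂ v with splitAt n₁ v
... | inj₁ _ = B₁
... | inj₂ w with splitAt m₁ w
...   | inj₁ _ = A₁
...   | inj₂ w′ with splitAt m₂ w′
...     | inj₁ _ = A₂
...     | inj₂ _ = B₂

-- Pairs of blocks between which all (distinct) vertices are adjacent.
data BlockEdge : Block → Block → Set where
  B₁B₁ : BlockEdge B₁ B₁
  B₂B₂ : BlockEdge B₂ B₂
  B₁A₁ : BlockEdge B₁ A₁
  A₁B₁ : BlockEdge A₁ B₁
  A₁A₂ : BlockEdge A₁ A₂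
  A₂A₁ : BlockEdge A₂ A₁
  A₂B₂ : BlockEdge A₂ B₂
  B₂A₂ : BlockEdge B₂ A₂

ΩAdj : (n₁ m₁ m₂ n₂ : ℕ) → Fin (ΩN n₁ m₁ m₂ n₂) → Fin (ΩN n₁ m₁ m₂ n₂) → Set
ΩAdj n₁ m₁ m₂ n₂ u v = u ≢ v × BlockEdge (block n₁ m₁ m₂ n₂ u) (block n₁ m₁ m₂ n₂ v)

blockWeight : Block → ℤ
blockWeight B₁ = + 1
blockWeight A₁ = + 2
blockWeight A₂ = + 2
blockWeight B₂ = + 1

Ωd : (n₁ m₁ m₂ n₂ : ℕ) → Fin (ΩN n₁ m₁ m₂ n₂) → ℤ
Ωd n₁ m₁ m₂ n₂ v = blockWeight (block n₁ m₁ m₂ n₂ v)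

target1133 : {n : ℕ} → Fin n → ℤ
target1133 i with toℕ i
... | 0 = + 1
... | 1 = + 1
... | 2 = + 3
... | 3 = + 3
... | _ = 0ℤ

{-# OPTIONS --safe #-}
-- Substituting x = d into D_X(Ω) yields a matrix whose (u, v) entry depends only on the
-- blocks of u and v: off the diagonal it is a distance between blocks, and on the diagonal
-- d_u happens to be the distance between two distinct vertices of u's block (1 in the
-- cliques B₁, B₂ and 2 in the independent sets A₁, A₂). Such a matrix is ℤ-equivalent to
-- its 4 × 4 block pattern W padded with zeros: permute one representative of each block
-- to the front, then subtract from every other row and column the one of its
-- representative. Explicit unimodular matrices reduce W to diag(1, 1, 3, 3).
--
-- W has rank 2 modulo 3: all its 3 × 3 minors, repeated rows and columns allowed, are
-- divisible by 3, and Laplace expansion propagates this to every minor of size i ≥ 3 of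
-- D_X(Ω) evaluated at x = d. Evaluating a relation 1 = Σ cₖ · minorₖ at x = d would give
-- 3 ∣ 1, so only I₁ and I₂ can be trivial.
module Submission where

open import Defs
open import Data.Nat using (ℕ; _≤_)
open import Data.Fin using (Fin)
open import Data.Product using (_×_)

open import Data.Nat as ℕ using (zero; suc; z≤n; s≤s; _<_)
import Data.Nat.Properties as ℕP
open import Data.Nat.Induction using (<-wellFounded)
open import Data.Integer as ℤ using (ℤ; +_; 0ℤ; 1ℤ; _+_; _*_; -_; _-_; _^_)
import Data.Integer.Properties as ℤP
import Data.Integer.Divisibility as Unsigned
open import Data.Integer.Divisibility.Signed using (_∣_; divides; _∣?_; ∣m∣n⇒∣m+n; ∣n⇒∣m*n)
open import Data.Integer.Tactic.RingSolver using (solve-∀)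
open import Data.Fin as Fin using (zero; suc; toℕ; splitAt; punchIn; _↑ˡ_; _↑ʳ_)
import Data.Fin.Properties as FinP
open import Data.Fin.Properties using (_≟_; all?)
open import Data.Fin.Patterns using (0F; 1F; 2F; 3F)
open import Data.Fin.Permutation
  using (Permutation′; _⟨$⟩ʳ_; _⟨$⟩ˡ_; inverseˡ; inverseʳ; flip; transpose; _∘ₚ_)
import Data.Fin.Permutation as Perm
open import Data.Vec using (Vec; _∷_; []; lookup; tabulate; replicate; zipWith)
open import Data.Vec.Properties using (≡-dec; tabulate-cong; lookup∘tabulate)
open import Data.List using (List; _∷_; []; _++_; map; length)
open import Data.Sum using (_⊎_; inj₁; inj₂; [_,_]′)
open import Data.Product using (Σ; _,_; proj₁; proj₂; map₁)
open import Function using (_∘_)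
open import Function.Definitions using (Injective; StrictlySurjective)
open import Induction.WellFounded using (Acc; acc)
open import Relation.Nullary using (¬_; Dec; yes; no; contradiction)
open import Relation.Nullary.Decidable using (from-yes; from-no; _→-dec_)
import Relation.Nullary.Decidable as Dec
open import Relation.Binary.PropositionalEquality
open import Relation.Binary.Bundles using (Setoid)
import Relation.Binary.Reasoning.Setoid as SetoidReasoning
open import Algebra.Properties.Semiring.Sum ℤP.+-*-semiring
  using (sum; sum-cong-≗; sum-replicate-zero; ∑-comm; ∑-distrib-+; *-distribˡ-sum; *-distribʳ-sum)

-- Sums and matrices over ℤ

sumFin≡sum : ∀ {n} (f : Fin n → ℤ) → sumFin f ≡ sum f
sumFin≡sum {zero}  f = refl
sumFin≡sum {suc n} f = cong (_+_ (f zero)) (sumFin≡sum (f ∘ suc))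

sum-zero : ∀ {n} {f : Fin n → ℤ} → (∀ k → f k ≡ 0ℤ) → sum f ≡ 0ℤ
sum-zero {n} f≡0 = trans (sum-cong-≗ f≡0) (sum-replicate-zero n)

sum-↑ : ∀ m {n} (f : Fin (m ℕ.+ n) → ℤ) → sum f ≡ sum (f ∘ (_↑ˡ n)) + sum (f ∘ (m ↑ʳ_))
sum-↑ zero    f = sym (ℤP.+-identityˡ (sum f))
sum-↑ (suc m) f = trans (cong (_+_ (f zero)) (sum-↑ m (f ∘ suc)))
                        (sym (ℤP.+-assoc (f zero) _ _))

idMat-refl : ∀ {n} (i : Fin n) → idMat i i ≡ 1ℤ
idMat-refl i with i ≟ i
... | yes _  = refl
... | no i≢i = contradiction refl i≢i

idMat-≢ : ∀ {n} {i j : Fin n} → i ≢ j → idMat i j ≡ 0ℤ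
idMat-≢ {i = i} {j} i≢j with i ≟ j
... | yes i≡j = contradiction i≡j i≢j
... | no _    = refl

idMat-sym : ∀ {n} (i j : Fin n) → idMat i j ≡ idMat j i
idMat-sym i j with i ≟ j
... | yes refl = sym (idMat-refl i)
... | no i≢j   = sym (idMat-≢ (i≢j ∘ sym))

idMat-suc : ∀ {n} (i j : Fin n) → idMat (suc i) (suc j) ≡ idMat i j
idMat-suc i j with i ≟ j
... | yes _ = refl
... | no _  = refl

sum-δˡ : ∀ {n} (i : Fin n) (g : Fin n → ℤ) → sum (λ k → idMat i k * g k) ≡ g i
sum-δˡ {suc n} zero g = begin
  1ℤ * g zero + sum (λ k → idMat zero (suc k) * g (suc k))
    ≡⟨ cong₂ _+_ (ℤP.*-identityˡ (g zero)) (sum-zero λ k → ℤP.*-zeroˡ (g (suc k))) ⟩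
  g zero + 0ℤ
    ≡⟨ ℤP.+-identityʳ (g zero) ⟩
  g zero
    ∎
  where open ≡-Reasoning
sum-δˡ {suc n} (suc i) g = begin
  0ℤ * g zero + sum (λ k → idMat (suc i) (suc k) * g (suc k))
    ≡⟨ ℤP.+-identityˡ _ ⟩
  sum (λ k → idMat (suc i) (suc k) * g (suc k))
    ≡⟨ sum-cong-≗ (λ k → cong (_* g (suc k)) (idMat-suc i k)) ⟩
  sum (λ k → idMat i k * g (suc k))
    ≡⟨ sum-δˡ i (g ∘ suc) ⟩
  g (suc i)
    ∎
  where open ≡-Reasoning

sum-δʳ : ∀ {n} (j : Fin n) (g : Fin n → ℤ) → sum (λ k → g k * idMat k j) ≡ g j
sum-δʳ j g = trans (sum-cong-≗ (λ k → trans (ℤP.*-comm (g k) _) (cong (_* g k) (idMat-sym k j))))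
                   (sum-δˡ j g)

infix 4 _≗M_
_≗M_ : ∀ {m n} → Mat m n → Mat m n → Set
A ≗M B = ∀ i j → A i j ≡ B i j

≗M-trans : ∀ {m n} {A B C : Mat m n} → A ≗M B → B ≗M C → A ≗M C
≗M-trans A≗B B≗C i j = trans (A≗B i j) (B≗C i j)

≗M-sym : ∀ {m n} {A B : Mat m n} → A ≗M B → B ≗M A
≗M-sym A≗B i j = sym (A≗B i j)

≗M-refl : ∀ {m n} {A : Mat m n} → A ≗M A
≗M-refl i j = refl

Mat-setoid : ℕ → ℕ → Setoid _ _
Mat-setoid m n = record
  { Carrier       = Mat m n
  ; _≈_           = _≗M_
  ; isEquivalence = record { refl = ≗M-refl ; sym = ≗M-sym ; trans = ≗M-trans }
  }

module ≗M-Reasoning {m n : ℕ} = SetoidReasoning (Mat-setoid m n)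

infix 30 _ᵀ
_ᵀ : ∀ {m n} → Mat m n → Mat n m
(A ᵀ) i j = A j i

𝟎 : ∀ {m n} → Mat m n
𝟎 _ _ = 0ℤ

⊗-sum : ∀ {m n p} (A : Mat m n) (B : Mat n p) i j → (A ⊗ B) i j ≡ sum (λ k → A i k * B k j)
⊗-sum A B i j = sumFin≡sum (λ k → A i k * B k j)

⊗-cong : ∀ {m n p} {A A′ : Mat m n} {B B′ : Mat n p} → A ≗M A′ → B ≗M B′ → A ⊗ B ≗M A′ ⊗ B′
⊗-cong {A = A} {A′} {B} {B′} A≗A′ B≗B′ i j = begin
  (A ⊗ B) i j                     ≡⟨ ⊗-sum A B i j ⟩
  sum (λ k → A i k * B k j)       ≡⟨ sum-cong-≗ (λ k → cong₂ _*_ (A≗A′ i k) (B≗B′ k j)) ⟩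
  sum (λ k → A′ i k * B′ k j)     ≡⟨ ⊗-sum A′ B′ i j ⟨
  (A′ ⊗ B′) i j                   ∎
  where open ≡-Reasoning

⊗-congˡ : ∀ {m n p} (A : Mat m n) {B B′ : Mat n p} → B ≗M B′ → A ⊗ B ≗M A ⊗ B′
⊗-congˡ A B≗B′ = ⊗-cong {A = A} (λ _ _ → refl) B≗B′

⊗-congʳ : ∀ {m n p} {A A′ : Mat m n} (B : Mat n p) → A ≗M A′ → A ⊗ B ≗M A′ ⊗ B
⊗-congʳ B A≗A′ = ⊗-cong {B = B} A≗A′ (λ _ _ → refl)

⊗-assoc : ∀ {m n p q} (A : Mat m n) (B : Mat n p) (C : Mat p q) → (A ⊗ B) ⊗ C ≗M A ⊗ (B ⊗ C)
⊗-assoc A B C i j = begin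
  ((A ⊗ B) ⊗ C) i j
    ≡⟨ ⊗-sum (A ⊗ B) C i j ⟩
  sum (λ k → (A ⊗ B) i k * C k j)
    ≡⟨ sum-cong-≗ (λ k → cong (_* C k j) (⊗-sum A B i k)) ⟩
  sum (λ k → sum (λ l → A i l * B l k) * C k j)
    ≡⟨ sum-cong-≗ (λ k → *-distribʳ-sum (C k j) (λ l → A i l * B l k)) ⟩
  sum (λ k → sum (λ l → A i l * B l k * C k j))
    ≡⟨ ∑-comm (λ k l → A i l * B l k * C k j) ⟩
  sum (λ l → sum (λ k → A i l * B l k * C k j))
    ≡⟨ sum-cong-≗ (λ l → sum-cong-≗ (λ k → ℤP.*-assoc (A i l) (B l k) (C k j))) ⟩
  sum (λ l → sum (λ k → A i l * (B l k * C k j)))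
    ≡⟨ sum-cong-≗ (λ l → *-distribˡ-sum (A i l) (λ k → B l k * C k j)) ⟨
  sum (λ l → A i l * sum (λ k → B l k * C k j))
    ≡⟨ sum-cong-≗ (λ l → cong (A i l *_) (⊗-sum B C l j)) ⟨
  sum (λ l → A i l * (B ⊗ C) l j)
    ≡⟨ ⊗-sum A (B ⊗ C) i j ⟨
  (A ⊗ (B ⊗ C)) i j
    ∎
  where open ≡-Reasoning

⊗-identityˡ : ∀ {m n} (A : Mat m n) → idMat ⊗ A ≗M A
⊗-identityˡ A i j = trans (⊗-sum idMat A i j) (sum-δˡ i (λ k → A k j))

⊗-identityʳ : ∀ {m n} (A : Mat m n) → A ⊗ idMat ≗M A
⊗-identityʳ A i j = trans (⊗-sum A idMat i j) (sum-δʳ j (A i))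

⊗-ᵀ : ∀ {m n p} (A : Mat m n) (B : Mat n p) → (A ⊗ B) ᵀ ≗M B ᵀ ⊗ A ᵀ
⊗-ᵀ A B i j = begin
  (A ⊗ B) j i                 ≡⟨ ⊗-sum A B j i ⟩
  sum (λ k → A j k * B k i)   ≡⟨ sum-cong-≗ (λ k → ℤP.*-comm (A j k) (B k i)) ⟩
  sum (λ k → B k i * A j k)   ≡⟨ ⊗-sum (B ᵀ) (A ᵀ) i j ⟨
  (B ᵀ ⊗ A ᵀ) i j             ∎
  where open ≡-Reasoning

⊗-cancel-middle : ∀ {m n p q} (A : Mat m n) (B : Mat n p) (C : Mat p n) (D : Mat n q) →
                  B ⊗ C ≗M idMat → (A ⊗ B) ⊗ (C ⊗ D) ≗M A ⊗ D
⊗-cancel-middle A B C D BC≗I = begin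
  (A ⊗ B) ⊗ (C ⊗ D)  ≈⟨ ⊗-assoc A B (C ⊗ D) ⟩
  A ⊗ (B ⊗ (C ⊗ D))  ≈⟨ ⊗-congˡ A (⊗-assoc B C D) ⟨
  A ⊗ ((B ⊗ C) ⊗ D)  ≈⟨ ⊗-congˡ A (⊗-congʳ D BC≗I) ⟩
  A ⊗ (idMat ⊗ D)    ≈⟨ ⊗-congˡ A (⊗-identityˡ D) ⟩
  A ⊗ D              ∎
  where open ≗M-Reasoning

Unimodular-⊗ : ∀ {n} {P P′ : Mat n n} → Unimodular P → Unimodular P′ → Unimodular (P ⊗ P′)
Unimodular-⊗ {P = P} {P′} (Q , PQ≗I , QP≗I) (Q′ , P′Q′≗I , Q′P′≗I) =
  Q′ ⊗ Q ,
  ≗M-trans (⊗-cancel-middle P P′ Q′ Q P′Q′≗I) PQ≗I ,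
  ≗M-trans (⊗-cancel-middle Q′ Q P P′ QP≗I) Q′P′≗I

Unimodular-ᵀ : ∀ {n} {P : Mat n n} → Unimodular P → Unimodular (P ᵀ)
Unimodular-ᵀ {P = P} (Q , PQ≗I , QP≗I) =
  Q ᵀ ,
  (λ i j → trans (sym (⊗-ᵀ Q P i j)) (trans (QP≗I j i) (idMat-sym j i))) ,
  (λ i j → trans (sym (⊗-ᵀ P Q i j)) (trans (PQ≗I j i) (idMat-sym j i)))

EquivZ-trans : ∀ {n} {M S T : Mat n n} → EquivZ M S → EquivZ S T → EquivZ M T
EquivZ-trans {M = M} {S} {T} (P , Q , uP , uQ , PMQ≗S) (P′ , Q′ , uP′ , uQ′ , P′SQ′≗T) =
  P′ ⊗ P , Q ⊗ Q′ , Unimodular-⊗ uP′ uP , Unimodular-⊗ uQ uQ′ , (begin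
    ((P′ ⊗ P) ⊗ M) ⊗ (Q ⊗ Q′)  ≈⟨ ⊗-assoc ((P′ ⊗ P) ⊗ M) Q Q′ ⟨
    (((P′ ⊗ P) ⊗ M) ⊗ Q) ⊗ Q′  ≈⟨ ⊗-congʳ Q′ (⊗-congʳ Q (⊗-assoc P′ P M)) ⟩
    ((P′ ⊗ (P ⊗ M)) ⊗ Q) ⊗ Q′  ≈⟨ ⊗-congʳ Q′ (⊗-assoc P′ (P ⊗ M) Q) ⟩
    (P′ ⊗ ((P ⊗ M) ⊗ Q)) ⊗ Q′  ≈⟨ ⊗-congʳ Q′ (⊗-congˡ P′ PMQ≗S) ⟩
    (P′ ⊗ S) ⊗ Q′              ≈⟨ P′SQ′≗T ⟩
    T                          ∎)
  where open ≗M-Reasoning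

EquivZ-respˡ : ∀ {n} {M M′ S : Mat n n} → M ≗M M′ → EquivZ M′ S → EquivZ M S
EquivZ-respˡ M≗M′ (P , Q , uP , uQ , PM′Q≗S) =
  P , Q , uP , uQ , ≗M-trans (⊗-congʳ Q (⊗-congˡ P M≗M′)) PM′Q≗S

EquivZ-respʳ : ∀ {n} {M S S′ : Mat n n} → EquivZ M S → S ≗M S′ → EquivZ M S′
EquivZ-respʳ (P , Q , uP , uQ , PMQ≗S) S≗S′ = P , Q , uP , uQ , ≗M-trans PMQ≗S S≗S′

EquivZ-congruence : ∀ {n} {P : Mat n n} → Unimodular P → (M : Mat n n) → EquivZ M ((P ⊗ M) ⊗ P ᵀ)
EquivZ-congruence uP M = _ , _ , uP , Unimodular-ᵀ uP , ≗M-refl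

matrix : ∀ {m n} → Vec (Vec ℤ n) m → Mat m n
matrix rows i j = lookup (lookup rows i) j

infix 4 _≟M_
_≟M_ : ∀ {m n} (A B : Mat m n) → Dec (A ≗M B)
A ≟M B = all? λ i → all? λ j → A i j ℤ.≟ B i j

permutationMatrix : ∀ {n} → Permutation′ n → Mat n n
permutationMatrix π i j = idMat (π ⟨$⟩ʳ i) j

permutationMatrix-⊗ : ∀ {n p} (π : Permutation′ n) (A : Mat n p) i j →
                      (permutationMatrix π ⊗ A) i j ≡ A (π ⟨$⟩ʳ i) j
permutationMatrix-⊗ π A i j = ⊗-identityˡ A (π ⟨$⟩ʳ i) j

⊗-permutationMatrixᵀ : ∀ {m n} (A : Mat m n) (π : Permutation′ n) i j →
                       (A ⊗ permutationMatrix π ᵀ) i j ≡ A i (π ⟨$⟩ʳ j)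
⊗-permutationMatrixᵀ A π i j = trans (⊗-congˡ A (λ k l → idMat-sym (π ⟨$⟩ʳ l) k) i j)
                                      (⊗-identityʳ A i (π ⟨$⟩ʳ j))

Unimodular-permutationMatrix : ∀ {n} (π : Permutation′ n) → Unimodular (permutationMatrix π)
Unimodular-permutationMatrix π =
  permutationMatrix (flip π) ,
  (λ i j → trans (permutationMatrix-⊗ π (permutationMatrix (flip π)) i j)
                 (cong (λ k → idMat k j) (inverseˡ π))) ,
  (λ i j → trans (permutationMatrix-⊗ (flip π) (permutationMatrix π) i j)
                 (cong (λ k → idMat k j) (inverseʳ π)))

EquivZ-permute : ∀ {n} (M : Mat n n) (π : Permutation′ n) →
                 EquivZ M (λ i j → M (π ⟨$⟩ʳ i) (π ⟨$⟩ʳ j))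
EquivZ-permute M π = EquivZ-respʳ (EquivZ-congruence (Unimodular-permutationMatrix π) M) λ i j →
  trans (⊗-permutationMatrixᵀ (permutationMatrix π ⊗ M) π i j)
        (permutationMatrix-⊗ π M i (π ⟨$⟩ʳ j))

transpose-source : ∀ {n} (i j : Fin n) → transpose i j ⟨$⟩ʳ i ≡ j
transpose-source i j with i ≟ i
... | yes _  = refl
... | no i≢i = contradiction refl i≢i

transpose-other : ∀ {n} {i j k : Fin n} → k ≢ i → k ≢ j → transpose i j ⟨$⟩ʳ k ≡ k
transpose-other {i = i} {j} {k} k≢i k≢j with k ≟ i
... | yes k≡i = contradiction k≡i k≢i
... | no _ with k ≟ j
...   | yes k≡j = contradiction k≡j k≢j
...   | no _    = refl

↑ˡ≢↑ʳ : ∀ {m n} (a : Fin m) (b : Fin n) → a ↑ˡ n ≢ m ↑ʳ b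
↑ˡ≢↑ʳ {m} {n} a b eq
  with trans (sym (FinP.splitAt-↑ˡ m a n)) (trans (cong (splitAt m) eq) (FinP.splitAt-↑ʳ m n b))
... | ()

diagMat-≡ : ∀ {n} (f : Fin n → ℤ) i → diagMat f i i ≡ f i
diagMat-≡ f i with i ≟ i
... | yes _  = refl
... | no i≢i = contradiction refl i≢i

diagMat-≢ : ∀ {n} (f : Fin n → ℤ) {i j} → i ≢ j → diagMat f i j ≡ 0ℤ
diagMat-≢ f {i} {j} i≢j with i ≟ j
... | yes i≡j = contradiction i≡j i≢j
... | no _    = refl

diagMat-cong : ∀ {n} {f g : Fin n → ℤ} → (∀ i → f i ≡ g i) → diagMat f ≗M diagMat g
diagMat-cong f≗g i j with i ≟ j
... | yes _ = f≗g i
... | no _  = refl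

diagMat-reindex : ∀ {m n} (g : Fin n → ℤ) (e : Fin m → Fin n) → (∀ {a b} → e a ≡ e b → a ≡ b) →
                    ∀ a b → diagMat (g ∘ e) a b ≡ diagMat g (e a) (e b)
diagMat-reindex g e e-inj a b with a ≟ b
... | yes refl = sym (diagMat-≡ g (e a))
... | no a≢b   = sym (diagMat-≢ g (a≢b ∘ e-inj))

idMat≗diagMat : ∀ {n} → idMat {n} ≗M diagMat (λ _ → 1ℤ)
idMat≗diagMat i j with i ≟ j
... | yes _ = refl
... | no _  = refl

𝟎≗diagMat : ∀ {n} → 𝟎 ≗M diagMat {n} (λ _ → 0ℤ)
𝟎≗diagMat i j with i ≟ j
... | yes _ = refl
... | no _  = refl

blockDiagonal : ∀ {m n} → Mat m m → Mat n n → Fin m ⊎ Fin n → Fin m ⊎ Fin n → ℤ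
blockDiagonal A B (inj₁ a) (inj₁ a′) = A a a′
blockDiagonal A B (inj₂ b) (inj₂ b′) = B b b′
blockDiagonal A B _        _         = 0ℤ

infixr 6 _⊕_
_⊕_ : ∀ {m n} → Mat m m → Mat n n → Mat (m ℕ.+ n) (m ℕ.+ n)
_⊕_ {m} A B i j = blockDiagonal A B (splitAt m i) (splitAt m j)

⊕-join : ∀ {m n} (A : Mat m m) (B : Mat n n) s t →
         (A ⊕ B) (Fin.join m n s) (Fin.join m n t) ≡ blockDiagonal A B s t
⊕-join {m} {n} A B s t = cong₂ (blockDiagonal A B) (FinP.splitAt-join m n s) (FinP.splitAt-join m n t)

≗M-by-blocks : ∀ {m n} {X Y : Mat (m ℕ.+ n) (m ℕ.+ n)} →
               (∀ s t → X (Fin.join m n s) (Fin.join m n t) ≡ Y (Fin.join m n s) (Fin.join m n t)) →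
               X ≗M Y
≗M-by-blocks {m} {n} {X} {Y} X≗Y i j =
  subst₂ (λ i j → X i j ≡ Y i j) (FinP.join-splitAt m n i) (FinP.join-splitAt m n j)
         (X≗Y (splitAt m i) (splitAt m j))

⊕-cong : ∀ {m n} {A A′ : Mat m m} {B B′ : Mat n n} → A ≗M A′ → B ≗M B′ → A ⊕ B ≗M A′ ⊕ B′
⊕-cong {m} A≗A′ B≗B′ i j = blocks (splitAt m i) (splitAt m j)
  where
  blocks : ∀ s t → blockDiagonal _ _ s t ≡ blockDiagonal _ _ s t
  blocks (inj₁ a) (inj₁ a′) = A≗A′ a a′
  blocks (inj₁ a) (inj₂ b′) = refl
  blocks (inj₂ b) (inj₁ a′) = refl
  blocks (inj₂ b) (inj₂ b′) = B≗B′ b b′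

⊕-⊗ : ∀ {m n} (A C : Mat m m) (B D : Mat n n) → (A ⊕ B) ⊗ (C ⊕ D) ≗M (A ⊗ C) ⊕ (B ⊗ D)
⊕-⊗ {m} {n} A C B D = ≗M-by-blocks λ s t → begin
  ((A ⊕ B) ⊗ (C ⊕ D)) (Fin.join m n s) (Fin.join m n t)
    ≡⟨ trans (⊗-sum (A ⊕ B) (C ⊕ D) _ _) (sum-↑ m _) ⟩
  sum (λ a → (A ⊕ B) (Fin.join m n s) (a ↑ˡ n) * (C ⊕ D) (a ↑ˡ n) (Fin.join m n t)) +
  sum (λ b → (A ⊕ B) (Fin.join m n s) (m ↑ʳ b) * (C ⊕ D) (m ↑ʳ b) (Fin.join m n t))
    ≡⟨ cong₂ _+_ (sum-cong-≗ λ a → cong₂ _*_ (⊕-join A B s (inj₁ a)) (⊕-join C D (inj₁ a) t))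
                 (sum-cong-≗ λ b → cong₂ _*_ (⊕-join A B s (inj₂ b)) (⊕-join C D (inj₂ b) t)) ⟩
  sum (λ a → blockDiagonal A B s (inj₁ a) * blockDiagonal C D (inj₁ a) t) +
  sum (λ b → blockDiagonal A B s (inj₂ b) * blockDiagonal C D (inj₂ b) t)
    ≡⟨ blocks s t ⟩
  blockDiagonal (A ⊗ C) (B ⊗ D) s t
    ≡⟨ ⊕-join (A ⊗ C) (B ⊗ D) s t ⟨
  ((A ⊗ C) ⊕ (B ⊗ D)) (Fin.join m n s) (Fin.join m n t)
    ∎
  where
  open ≡-Reasoning
  blocks : ∀ s t → sum (λ a → blockDiagonal A B s (inj₁ a) * blockDiagonal C D (inj₁ a) t) +
                   sum (λ b → blockDiagonal A B s (inj₂ b) * blockDiagonal C D (inj₂ b) t) ≡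
                   blockDiagonal (A ⊗ C) (B ⊗ D) s t
  blocks (inj₁ a) (inj₁ a′) = trans (cong₂ _+_ (sym (⊗-sum A C a a′)) (sum-zero {n} λ _ → refl))
                                    (ℤP.+-identityʳ _)
  blocks (inj₁ a) (inj₂ b′) = cong₂ _+_ (sum-zero λ k → ℤP.*-zeroʳ (A a k))
                                        (sum-zero λ k → ℤP.*-zeroˡ (D k b′))
  blocks (inj₂ b) (inj₁ a′) = cong₂ _+_ (sum-zero λ k → ℤP.*-zeroˡ (C k a′))
                                        (sum-zero λ k → ℤP.*-zeroʳ (B b k))
  blocks (inj₂ b) (inj₂ b′) = trans (cong₂ _+_ (sum-zero {m} λ _ → refl) (sym (⊗-sum B D b b′)))
                                    (ℤP.+-identityˡ _)

diagMat-⊕ : ∀ {m n} (f : Fin m → ℤ) (g : Fin n → ℤ) →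
            diagMat f ⊕ diagMat g ≗M diagMat (λ i → [ f , g ]′ (splitAt m i))
diagMat-⊕ {m} {n} f g = ≗M-by-blocks λ s t → trans (⊕-join (diagMat f) (diagMat g) s t) (blocks s t)
  where
  h : Fin (m ℕ.+ n) → ℤ
  h i = [ f , g ]′ (splitAt m i)
  blocks : ∀ s t → blockDiagonal (diagMat f) (diagMat g) s t ≡ diagMat h (Fin.join m n s) (Fin.join m n t)
  blocks (inj₁ a) (inj₁ a′) =
    trans (diagMat-cong (λ a → cong [ f , g ]′ (sym (FinP.splitAt-↑ˡ m a n))) a a′)
          (diagMat-reindex h (_↑ˡ n) (FinP.↑ˡ-injective n _ _) a a′)
  blocks (inj₁ a) (inj₂ b′) = sym (diagMat-≢ h (↑ˡ≢↑ʳ a b′))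
  blocks (inj₂ b) (inj₁ a′) = sym (diagMat-≢ h (↑ˡ≢↑ʳ a′ b ∘ sym))
  blocks (inj₂ b) (inj₂ b′) =
    trans (diagMat-cong (λ b → cong [ f , g ]′ (sym (FinP.splitAt-↑ʳ m n b))) b b′)
          (diagMat-reindex h (m ↑ʳ_) (FinP.↑ʳ-injective m _ _) b b′)

⊕-identity : ∀ {m n} → idMat {m} ⊕ idMat {n} ≗M idMat
⊕-identity {m} {n} = begin
  idMat {m} ⊕ idMat {n}                 ≈⟨ ⊕-cong (idMat≗diagMat {m}) (idMat≗diagMat {n}) ⟩
  diagMat {m} one ⊕ diagMat {n} one     ≈⟨ diagMat-⊕ {m} {n} one one ⟩
  diagMat (λ i → [ one , one ]′ (splitAt m i)) ≈⟨ diagMat-cong (λ i → [,]-one (splitAt m i)) ⟩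
  diagMat one                           ≈⟨ idMat≗diagMat ⟨
  idMat                                 ∎
  where
  open ≗M-Reasoning {m ℕ.+ n} {m ℕ.+ n}
  one : ∀ {k} → Fin k → ℤ
  one _ = 1ℤ
  [,]-one : (s : Fin m ⊎ Fin n) → [ one , one ]′ s ≡ 1ℤ
  [,]-one (inj₁ _) = refl
  [,]-one (inj₂ _) = refl

Unimodular-⊕ : ∀ {m n} {A : Mat m m} {B : Mat n n} → Unimodular A → Unimodular B → Unimodular (A ⊕ B)
Unimodular-⊕ {m} {n} {A} {B} (A⁻¹ , AA⁻¹≗I , A⁻¹A≗I) (B⁻¹ , BB⁻¹≗I , B⁻¹B≗I) =
  A⁻¹ ⊕ B⁻¹ ,
  ≗M-trans (⊕-⊗ A A⁻¹ B B⁻¹) (≗M-trans (⊕-cong AA⁻¹≗I BB⁻¹≗I) (⊕-identity {m} {n})) ,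
  ≗M-trans (⊕-⊗ A⁻¹ A B⁻¹ B) (≗M-trans (⊕-cong A⁻¹A≗I B⁻¹B≗I) (⊕-identity {m} {n}))

EquivZ-⊕ : ∀ {m n} {A B : Mat m m} (C : Mat n n) → EquivZ A B → EquivZ (A ⊕ C) (B ⊕ C)
EquivZ-⊕ {A = A} {B} C (P , Q , uP , uQ , PAQ≗B) =
  P ⊕ idMat , Q ⊕ idMat , Unimodular-⊕ uP uId , Unimodular-⊕ uQ uId , (begin
    ((P ⊕ idMat) ⊗ (A ⊕ C)) ⊗ (Q ⊕ idMat)  ≈⟨ ⊗-congʳ (Q ⊕ idMat) (⊕-⊗ P A idMat C) ⟩
    ((P ⊗ A) ⊕ (idMat ⊗ C)) ⊗ (Q ⊕ idMat)  ≈⟨ ⊕-⊗ (P ⊗ A) Q (idMat ⊗ C) idMat ⟩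
    ((P ⊗ A) ⊗ Q) ⊕ ((idMat ⊗ C) ⊗ idMat)  ≈⟨ ⊕-cong PAQ≗B (≗M-trans (⊗-identityʳ _) (⊗-identityˡ C)) ⟩
    B ⊕ C                                  ∎)
  where
  open ≗M-Reasoning
  uId : Unimodular idMat
  uId = idMat , ⊗-identityˡ idMat , ⊗-identityˡ idMat

-- Class matrices

rowAddition : ∀ {n} → (Fin n → ℤ) → (Fin n → Fin n) → Mat n n
rowAddition w r i k = idMat i k + w i * idMat (r i) k

rowAddition-⊗ : ∀ {n p} (w : Fin n → ℤ) (r : Fin n → Fin n) (X : Mat n p) i j →
                (rowAddition w r ⊗ X) i j ≡ X i j + w i * X (r i) j
rowAddition-⊗ w r X i j = begin
  (rowAddition w r ⊗ X) i j
    ≡⟨ ⊗-sum (rowAddition w r) X i j ⟩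
  sum (λ k → (idMat i k + w i * idMat (r i) k) * X k j)
    ≡⟨ sum-cong-≗ (λ k → distrib (idMat i k) (w i) (idMat (r i) k) (X k j)) ⟩
  sum (λ k → idMat i k * X k j + w i * (idMat (r i) k * X k j))
    ≡⟨ ∑-distrib-+ (λ k → idMat i k * X k j) _ ⟩
  sum (λ k → idMat i k * X k j) + sum (λ k → w i * (idMat (r i) k * X k j))
    ≡⟨ cong₂ _+_ (sum-δˡ i (λ k → X k j)) (sym (*-distribˡ-sum (w i) (λ k → idMat (r i) k * X k j))) ⟩
  X i j + w i * sum (λ k → idMat (r i) k * X k j)
    ≡⟨ cong (λ y → X i j + w i * y) (sum-δˡ (r i) (λ k → X k j)) ⟩
  X i j + w i * X (r i) j
    ∎
  where
  open ≡-Reasoning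
  distrib : ∀ a l b x → (a + l * b) * x ≡ a * x + l * (b * x)
  distrib = solve-∀

Unimodular-rowAddition : ∀ {n} (w : Fin n → ℤ) (r : Fin n → Fin n) → (∀ i → w (r i) ≡ 0ℤ) →
                         Unimodular (rowAddition w r)
Unimodular-rowAddition w r w∘r≡0 =
  rowAddition (-_ ∘ w) r ,
  cancel w (-_ ∘ w) (λ i → ℤP.+-inverseʳ (w i)) (λ i → cong -_ (w∘r≡0 i)) ,
  cancel (-_ ∘ w) w (λ i → ℤP.+-inverseˡ (w i)) w∘r≡0
  where
  cancel : ∀ v v′ → (∀ i → v i + v′ i ≡ 0ℤ) → (∀ i → v′ (r i) ≡ 0ℤ) →
           rowAddition v r ⊗ rowAddition v′ r ≗M idMat
  cancel v v′ v+v′≡0 v′∘r≡0 i j = begin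
    (rowAddition v r ⊗ rowAddition v′ r) i j
      ≡⟨ rowAddition-⊗ v r (rowAddition v′ r) i j ⟩
    (δ + v′ i * δʳ) + v i * (δʳ + v′ (r i) * idMat (r (r i)) j)
      ≡⟨ cong (λ x → (δ + v′ i * δʳ) + v i * (δʳ + x * idMat (r (r i)) j)) (v′∘r≡0 i) ⟩
    (δ + v′ i * δʳ) + v i * (δʳ + 0ℤ * idMat (r (r i)) j)
      ≡⟨ collect δ δʳ (idMat (r (r i)) j) (v i) (v′ i) ⟩
    δ + (v i + v′ i) * δʳ
      ≡⟨ cong (λ x → δ + x * δʳ) (v+v′≡0 i) ⟩
    δ + 0ℤ * δʳ
      ≡⟨ ℤP.+-identityʳ δ ⟩
    δ ∎
    where
    open ≡-Reasoning
    δ δʳ : ℤ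
    δ  = idMat i j
    δʳ = idMat (r i) j
    collect : ∀ a b c x y → (a + y * b) + x * (b + 0ℤ * c) ≡ a + (x + y) * b
    collect = solve-∀

classMatrix : ∀ {m N} → Mat m m → (Fin N → Fin m) → Mat N N
classMatrix W c i j = W (c i) (c j)

module ClassReduction {m K : ℕ} (W : Mat m m) (c : Fin (m ℕ.+ K) → Fin m)
                      (c-↑ˡ : ∀ k → c (k ↑ˡ K) ≡ k) where

  isLeft : Fin (m ℕ.+ K) → ℤ
  isLeft i = [ (λ _ → 1ℤ) , (λ _ → 0ℤ) ]′ (splitAt m i)

  isLeft-join : ∀ s → isLeft (Fin.join m K s) ≡ [ (λ _ → 1ℤ) , (λ _ → 0ℤ) ]′ s
  isLeft-join s = cong [ (λ _ → 1ℤ) , (λ _ → 0ℤ) ]′ (FinP.splitAt-join m K s)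

  representative : Fin (m ℕ.+ K) → Fin (m ℕ.+ K)
  representative i = c i ↑ˡ K

  -- Subtracts from every row outside the first m the row of its class representative.
  clear : Mat (m ℕ.+ K) (m ℕ.+ K)
  clear = rowAddition (λ i → isLeft i - 1ℤ) representative

  clear-unimodular : Unimodular clear
  clear-unimodular = Unimodular-rowAddition (λ i → isLeft i - 1ℤ) representative
    (λ i → cong (_- 1ℤ) (isLeft-join (inj₁ (c i))))

  clear-⊗ : (Y : Mat (m ℕ.+ K) (m ℕ.+ K)) → (∀ i j → Y (representative i) j ≡ Y i j) →
            ∀ i j → (clear ⊗ Y) i j ≡ isLeft i * Y i j
  clear-⊗ Y Y-const i j = begin
    (clear ⊗ Y) i j
      ≡⟨ rowAddition-⊗ (λ i → isLeft i - 1ℤ) representative Y i j ⟩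
    Y i j + (isLeft i - 1ℤ) * Y (representative i) j
      ≡⟨ cong (λ y → Y i j + (isLeft i - 1ℤ) * y) (Y-const i j) ⟩
    Y i j + (isLeft i - 1ℤ) * Y i j
      ≡⟨ absorb (Y i j) (isLeft i) ⟩
    isLeft i * Y i j
      ∎
    where
    open ≡-Reasoning
    absorb : ∀ y l → y + (l - 1ℤ) * y ≡ l * y
    absorb = solve-∀

  M : Mat (m ℕ.+ K) (m ℕ.+ K)
  M = classMatrix W c

  clear-M : ∀ i j → (clear ⊗ M) i j ≡ isLeft i * M i j
  clear-M = clear-⊗ M (λ i j → cong (λ k → W k (c j)) (c-↑ˡ (c i)))

  clear-M-clear : ∀ i j → ((clear ⊗ M) ⊗ clear ᵀ) i j ≡ isLeft j * (isLeft i * M i j)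
  clear-M-clear i j = begin
    ((clear ⊗ M) ⊗ clear ᵀ) i j          ≡⟨ ⊗-ᵀ clear ((clear ⊗ M) ᵀ) i j ⟨
    (clear ⊗ (clear ⊗ M) ᵀ) j i          ≡⟨ clear-⊗ ((clear ⊗ M) ᵀ) columns j i ⟩
    isLeft j * (clear ⊗ M) i j            ≡⟨ cong (isLeft j *_) (clear-M i j) ⟩
    isLeft j * (isLeft i * M i j)         ∎
    where
    open ≡-Reasoning
    columns : ∀ j i → (clear ⊗ M) i (representative j) ≡ (clear ⊗ M) i j
    columns j i = trans (clear-M i (representative j))
                        (trans (cong (λ k → isLeft i * W (c i) k) (c-↑ˡ (c j))) (sym (clear-M i j)))

  reduction : EquivZ M (W ⊕ 𝟎)
  reduction = EquivZ-respʳ (EquivZ-congruence clear-unimodular M) (≗M-by-blocks λ s t →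
    trans (clear-M-clear (Fin.join m K s) (Fin.join m K t))
          (trans (blocks s t) (sym (⊕-join W 𝟎 s t))))
    where
    blocks : ∀ s t → isLeft (Fin.join m K t) * (isLeft (Fin.join m K s) * M (Fin.join m K s) (Fin.join m K t))
                     ≡ blockDiagonal W 𝟎 s t
    blocks (inj₁ a) (inj₁ b) rewrite isLeft-join (inj₁ a) | isLeft-join (inj₁ b) | c-↑ˡ a | c-↑ˡ b =
      trans (ℤP.*-identityˡ _) (ℤP.*-identityˡ _)
    blocks (inj₁ a) (inj₂ b) rewrite isLeft-join (inj₂ {A = Fin m} b) = refl
    blocks (inj₂ a) (inj₁ b) rewrite isLeft-join (inj₂ {A = Fin m} a) = ℤP.*-zeroʳ (isLeft (b ↑ˡ K))
    blocks (inj₂ a) (inj₂ b) rewrite isLeft-join (inj₂ {A = Fin m} b) = refl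

module Arrangement {m K : ℕ} (c : Fin (m ℕ.+ K) → Fin m) (c-surjective : StrictlySurjective _≡_ c) where

  PlacedBelow : ℕ → Permutation′ (m ℕ.+ K) → Set
  PlacedBelow n π = ∀ (k : Fin m) → toℕ k < n → c (π ⟨$⟩ʳ (k ↑ˡ K)) ≡ k

  -- Step n swaps position n with a vertex of class n. That vertex is not at a position
  -- below n, since those hold the classes below n, so the earlier placements survive.
  arrange : ∀ n → n ≤ m → Σ (Permutation′ (m ℕ.+ K)) (PlacedBelow n)
  arrange zero    _   = Perm.id , λ _ ()
  arrange (suc n) n<m with arrange n (ℕP.<⇒≤ n<m)
  ... | π , placed = transpose p i ∘ₚ π , placed′
    where
    k₀ : Fin m
    k₀ = Fin.fromℕ< n<m
    p i : Fin (m ℕ.+ K)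
    p = k₀ ↑ˡ K
    i = π ⟨$⟩ˡ proj₁ (c-surjective k₀)
    c-π-i : c (π ⟨$⟩ʳ i) ≡ k₀
    c-π-i = trans (cong c (inverseʳ π)) (proj₂ (c-surjective k₀))
    placed′ : PlacedBelow (suc n) (transpose p i ∘ₚ π)
    placed′ k k≤n with toℕ k ℕ.≟ n
    ... | yes k≡n rewrite FinP.toℕ-injective {i = k} {j = k₀} (trans k≡n (sym (FinP.toℕ-fromℕ< n<m))) =
      trans (cong (λ x → c (π ⟨$⟩ʳ x)) (transpose-source p i)) c-π-i
    ... | no k≢n = trans (cong (λ x → c (π ⟨$⟩ʳ x)) (transpose-other k↑≢p k↑≢i)) (placed k k<n)
      where
      k<n : toℕ k < n
      k<n = ℕP.≤∧≢⇒< (ℕP.≤-pred k≤n) k≢n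
      k≢k₀ : k ≢ k₀
      k≢k₀ k≡k₀ = k≢n (trans (cong toℕ k≡k₀) (FinP.toℕ-fromℕ< n<m))
      k↑≢p : k ↑ˡ K ≢ p
      k↑≢p = k≢k₀ ∘ FinP.↑ˡ-injective K k k₀
      k↑≢i : k ↑ˡ K ≢ i
      k↑≢i k↑≡i = k≢k₀ (trans (sym (placed k k<n)) (trans (cong (λ x → c (π ⟨$⟩ʳ x)) k↑≡i) c-π-i))

  arranged : Σ (Permutation′ (m ℕ.+ K)) λ π → ∀ k → c (π ⟨$⟩ʳ (k ↑ˡ K)) ≡ k
  arranged with arrange m ℕP.≤-refl
  ... | π , placed = π , λ k → placed k (FinP.toℕ<n k)

classMatrix-equiv : ∀ {m K} (W : Mat m m) (c : Fin (m ℕ.+ K) → Fin m) → StrictlySurjective _≡_ c →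
                    EquivZ (classMatrix W c) (W ⊕ 𝟎)
classMatrix-equiv W c c-surjective with Arrangement.arranged c c-surjective
... | π , c-π-↑ˡ = EquivZ-trans (EquivZ-permute (classMatrix W c) π)
                                (ClassReduction.reduction W (c ∘ (π ⟨$⟩ʳ_)) c-π-↑ˡ)

surjective⇒≤ : ∀ {m n} {f : Fin m → Fin n} → StrictlySurjective _≡_ f → n ≤ m
surjective⇒≤ {f = f} f-surjective = FinP.injective⇒≤ λ {y} {y′} eq →
  trans (sym (proj₂ (f-surjective y))) (trans (cong f eq) (proj₂ (f-surjective y′)))

-- Evaluation of polynomials

monomial : ∀ {N} → (Fin N → ℤ) → Monomial N → ℤ
monomial x []      = 1ℤ
monomial x (k ∷ α) = x zero ^ k * monomial (x ∘ suc) α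

eval : ∀ {N} → (Fin N → ℤ) → Poly N → ℤ
eval x []            = 0ℤ
eval x ((c , α) ∷ p) = c * monomial x α + eval x p

monomial-zipWith : ∀ {N} (x : Fin N → ℤ) (α β : Monomial N) →
                   monomial x (zipWith ℕ._+_ α β) ≡ monomial x α * monomial x β
monomial-zipWith x []      []      = refl
monomial-zipWith x (k ∷ α) (l ∷ β) = begin
  x zero ^ (k ℕ.+ l) * monomial (x ∘ suc) (zipWith ℕ._+_ α β)
    ≡⟨ cong₂ _*_ (ℤP.^-distribˡ-+-* (x zero) k l) (monomial-zipWith (x ∘ suc) α β) ⟩
  (x zero ^ k * x zero ^ l) * (monomial (x ∘ suc) α * monomial (x ∘ suc) β)
    ≡⟨ interchange (x zero ^ k) (x zero ^ l) (monomial (x ∘ suc) α) (monomial (x ∘ suc) β) ⟩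
  (x zero ^ k * monomial (x ∘ suc) α) * (x zero ^ l * monomial (x ∘ suc) β)
    ∎
  where
  open ≡-Reasoning
  interchange : ∀ a b c d → (a * b) * (c * d) ≡ (a * c) * (b * d)
  interchange = solve-∀

monomial-replicate-0 : ∀ {N} (x : Fin N → ℤ) → monomial x (replicate N 0) ≡ 1ℤ
monomial-replicate-0 {zero}  x = refl
monomial-replicate-0 {suc N} x = trans (ℤP.*-identityˡ _) (monomial-replicate-0 (x ∘ suc))

monomial-tabulate-0 : ∀ {N} (x : Fin N → ℤ) → monomial x (tabulate (λ _ → 0)) ≡ 1ℤ
monomial-tabulate-0 {zero}  x = refl
monomial-tabulate-0 {suc N} x = trans (ℤP.*-identityˡ _) (monomial-tabulate-0 (x ∘ suc))

δℕ : ∀ {N} → Fin N → Fin N → ℕ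
δℕ i j with i ≟ j
... | yes _ = 1
... | no _  = 0

δℕ-suc : ∀ {N} (i j : Fin N) → δℕ (suc i) (suc j) ≡ δℕ i j
δℕ-suc i j with i ≟ j
... | yes _ = refl
... | no _  = refl

monomial-δ : ∀ {N} (x : Fin N → ℤ) (i : Fin N) → monomial x (tabulate (δℕ i)) ≡ x i
monomial-δ x zero    = trans (cong (x zero * 1ℤ *_) (monomial-tabulate-0 (x ∘ suc)))
                             (trans (ℤP.*-identityʳ _) (ℤP.*-identityʳ (x zero)))
monomial-δ x (suc i) = trans (ℤP.*-identityˡ _)
                             (trans (cong (monomial (x ∘ suc)) (tabulate-cong (δℕ-suc i)))
                                    (monomial-δ (x ∘ suc) i))

-- The exponent vector of varP i tabulates a function local to varP, which cannot be
-- named here; the left-hand side of varP-exponent is inferred from its use in varP≡.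
mutual
  varP≡ : ∀ {N} (i : Fin N) → varP i ≡ (1ℤ , tabulate (δℕ i)) ∷ []
  varP≡ i = cong (λ α → (1ℤ , α) ∷ []) (tabulate-cong (varP-exponent i))

  varP-exponent : ∀ {N} (i j : Fin N) → _ ≡ δℕ i j
  varP-exponent i j with i ≟ j
  ... | yes _ = refl
  ... | no _  = refl

det : ∀ {n} → Mat n n → ℤ
det {zero}  A = 1ℤ
det {suc n} A = sum λ j → sign j * (A zero j * det (λ a b → A (suc a) (punchIn j b)))

det-cong : ∀ {n} {A B : Mat n n} → A ≗M B → det A ≡ det B
det-cong {zero}  A≗B = refl
det-cong {suc n} A≗B = sum-cong-≗ λ j →
  cong (sign j *_) (cong₂ _*_ (A≗B zero j) (det-cong λ a b → A≗B (suc a) (punchIn j b)))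

negP : ∀ {N} → Poly N → Poly N
negP = map (map₁ λ c → - c)

removeMonomial : ∀ {N} → Monomial N → Poly N → Poly N
removeMonomial α []            = []
removeMonomial α ((c , β) ∷ p) with ≡-dec ℕ._≟_ β α
... | yes _ = removeMonomial α p
... | no _  = (c , β) ∷ removeMonomial α p

coeff-++ : ∀ {N} (p q : Poly N) e → coeff (p ++ q) e ≡ coeff p e + coeff q e
coeff-++ []            q e = sym (ℤP.+-identityˡ (coeff q e))
coeff-++ ((c , α) ∷ p) q e with ≡-dec ℕ._≟_ α e
... | yes _ = trans (cong (_+_ c) (coeff-++ p q e)) (sym (ℤP.+-assoc c (coeff p e) (coeff q e)))
... | no _  = coeff-++ p q e

coeff-negP : ∀ {N} (p : Poly N) e → coeff (negP p) e ≡ - coeff p e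
coeff-negP []            e = refl
coeff-negP ((c , α) ∷ p) e with ≡-dec ℕ._≟_ α e
... | yes _ = trans (cong (_+_ (- c)) (coeff-negP p e)) (sym (ℤP.neg-distrib-+ c (coeff p e)))
... | no _  = coeff-negP p e

coeff-removeMonomial-≢ : ∀ {N} {α e : Monomial N} (p : Poly N) → α ≢ e →
                         coeff (removeMonomial α p) e ≡ coeff p e
coeff-removeMonomial-≢ []            α≢e = refl
coeff-removeMonomial-≢ {α = α} {e} ((c , β) ∷ p) α≢e with ≡-dec ℕ._≟_ β α
... | yes refl with ≡-dec ℕ._≟_ β e
...   | yes β≡e = contradiction β≡e α≢e
...   | no _    = coeff-removeMonomial-≢ p α≢e
coeff-removeMonomial-≢ {α = α} {e} ((c , β) ∷ p) α≢e | no _ with ≡-dec ℕ._≟_ β e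
...   | yes _ = cong (_+_ c) (coeff-removeMonomial-≢ p α≢e)
...   | no _  = coeff-removeMonomial-≢ p α≢e

coeff-removeMonomial-≡ : ∀ {N} (α : Monomial N) p → coeff (removeMonomial α p) α ≡ 0ℤ
coeff-removeMonomial-≡ α []            = refl
coeff-removeMonomial-≡ α ((c , β) ∷ p) with ≡-dec ℕ._≟_ β α
... | yes _   = coeff-removeMonomial-≡ α p
... | no β≢α with ≡-dec ℕ._≟_ β α
...   | yes β≡α = contradiction β≡α β≢α
...   | no _    = coeff-removeMonomial-≡ α p

length-removeMonomial : ∀ {N} (α : Monomial N) p → length (removeMonomial α p) ≤ length p
length-removeMonomial α []            = z≤n
length-removeMonomial α ((c , β) ∷ p) with ≡-dec ℕ._≟_ β α
... | yes _ = ℕP.m≤n⇒m≤1+n (length-removeMonomial α p)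
... | no _  = s≤s (length-removeMonomial α p)

module _ {N : ℕ} (x : Fin N → ℤ) where

  eval-++ : ∀ p q → eval x (p ++ q) ≡ eval x p + eval x q
  eval-++ []            q = sym (ℤP.+-identityˡ (eval x q))
  eval-++ ((c , α) ∷ p) q = trans (cong (_+_ (c * monomial x α)) (eval-++ p q))
                                  (sym (ℤP.+-assoc (c * monomial x α) (eval x p) (eval x q)))

  eval-*P : ∀ p q → eval x (p *P q) ≡ eval x p * eval x q
  eval-*P []            q = sym (ℤP.*-zeroˡ (eval x q))
  eval-*P ((a , α) ∷ p) q = begin
    eval x (scaled q ++ p *P q)
      ≡⟨ eval-++ (scaled q) (p *P q) ⟩
    eval x (scaled q) + eval x (p *P q)
      ≡⟨ cong₂ _+_ (eval-scaled q) (eval-*P p q) ⟩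
    a * monomial x α * eval x q + eval x p * eval x q
      ≡⟨ ℤP.*-distribʳ-+ (eval x q) (a * monomial x α) (eval x p) ⟨
    (a * monomial x α + eval x p) * eval x q
      ∎
    where
    open ≡-Reasoning
    scaled : Poly N → Poly N
    scaled = map λ { (b , β) → (a * b , zipWith ℕ._+_ α β) }
    eval-scaled : ∀ q → eval x (scaled q) ≡ a * monomial x α * eval x q
    eval-scaled []            = sym (ℤP.*-zeroʳ (a * monomial x α))
    eval-scaled ((b , β) ∷ q) = begin
      a * b * monomial x (zipWith ℕ._+_ α β) + eval x (scaled q)
        ≡⟨ cong₂ _+_ (cong (a * b *_) (monomial-zipWith x α β)) (eval-scaled q) ⟩
      a * b * (monomial x α * monomial x β) + a * monomial x α * eval x q
        ≡⟨ regroup a b (monomial x α) (monomial x β) (eval x q) ⟩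
      a * monomial x α * (b * monomial x β + eval x q)
        ∎
      where
      regroup : ∀ a b m n e → a * b * (m * n) + a * m * e ≡ a * m * (b * n + e)
      regroup = solve-∀

  eval-constP : ∀ c → eval x (constP c) ≡ c
  eval-constP c = trans (ℤP.+-identityʳ _) (trans (cong (c *_) (monomial-replicate-0 x)) (ℤP.*-identityʳ c))

  eval-varP : ∀ i → eval x (varP i) ≡ x i
  eval-varP i = begin
    eval x (varP i)                            ≡⟨ cong (eval x) (varP≡ i) ⟩
    1ℤ * monomial x (tabulate (δℕ i)) + 0ℤ     ≡⟨ ℤP.+-identityʳ _ ⟩
    1ℤ * monomial x (tabulate (δℕ i))          ≡⟨ ℤP.*-identityˡ _ ⟩
    monomial x (tabulate (δℕ i))               ≡⟨ monomial-δ x i ⟩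
    x i                                        ∎
    where open ≡-Reasoning

  eval-sumFinP : ∀ {n} (f : Fin n → Poly N) → eval x (sumFinP f) ≡ sum (eval x ∘ f)
  eval-sumFinP {zero}  f = refl
  eval-sumFinP {suc n} f =
    trans (eval-++ (f zero) (sumFinP (f ∘ suc))) (cong (_+_ (eval x (f zero))) (eval-sumFinP (f ∘ suc)))

  eval-scaleP : ∀ c p → eval x (scaleP c p) ≡ c * eval x p
  eval-scaleP c p = trans (eval-*P (constP c) p) (cong (_* eval x p) (eval-constP c))

  eval-detP : ∀ {n} (A : Fin n → Fin n → Poly N) → eval x (detP A) ≡ det (λ a b → eval x (A a b))
  eval-detP {zero}  A = eval-constP 1ℤ
  eval-detP {suc n} A =
    trans (eval-sumFinP λ j → scaleP (sign j) (A zero j *P detP (minor j))) (sum-cong-≗ λ j → begin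
    eval x (scaleP (sign j) (A zero j *P detP (minor j)))
      ≡⟨ eval-scaleP (sign j) (A zero j *P detP (minor j)) ⟩
    sign j * eval x (A zero j *P detP (minor j))
      ≡⟨ cong (sign j *_) (eval-*P (A zero j) (detP (minor j))) ⟩
    sign j * (eval x (A zero j) * eval x (detP (minor j)))
      ≡⟨ cong (λ d → sign j * (eval x (A zero j) * d)) (eval-detP (minor j)) ⟩
    sign j * (eval x (A zero j) * det (λ a b → eval x (minor j a b)))
      ∎)
    where
    open ≡-Reasoning
    minor : Fin (suc n) → Fin n → Fin n → Poly N
    minor j a b = A (suc a) (punchIn j b)

  eval-DX : ∀ (dist : Fin N → Fin N → ℕ) u v → eval x (DX dist u v) ≡ DXeval x dist u v
  eval-DX dist u v with u ≟ v
  ... | yes _ = trans (eval-++ (varP u) (constP (+ dist u v)))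
                      (cong₂ _+_ (eval-varP u) (eval-constP (+ dist u v)))
  ... | no _  = eval-constP (+ dist u v)

  eval-negP : ∀ p → eval x (negP p) ≡ - eval x p
  eval-negP []            = refl
  eval-negP ((c , α) ∷ p) =
    trans (cong (_+_ (- c * monomial x α)) (eval-negP p)) (negate c (monomial x α) (eval x p))
    where
    negate : ∀ c m e → - c * m + - e ≡ - (c * m + e)
    negate = solve-∀

  eval-removeMonomial : ∀ α p → eval x p ≡ coeff p α * monomial x α + eval x (removeMonomial α p)
  eval-removeMonomial α []            = refl
  eval-removeMonomial α ((c , β) ∷ p) with ≡-dec ℕ._≟_ β α
  ... | yes refl = trans (cong (_+_ (c * monomial x β)) (eval-removeMonomial β p))
                         (collect c (coeff p β) (monomial x β) (eval x (removeMonomial β p)))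
    where
    collect : ∀ c k m e → c * m + (k * m + e) ≡ (c + k) * m + e
    collect = solve-∀
  ... | no _     = trans (cong (_+_ (c * monomial x β)) (eval-removeMonomial α p))
                         (swap (c * monomial x β) (coeff p α * monomial x α) (eval x (removeMonomial α p)))
    where
    swap : ∀ a b e → a + (b + e) ≡ b + (a + e)
    swap = solve-∀

  eval-null : ∀ p → (∀ e → coeff p e ≡ 0ℤ) → eval x p ≡ 0ℤ
  eval-null p = go p (<-wellFounded (length p))
    where
    go : ∀ p → Acc ℕ._<_ (length p) → (∀ e → coeff p e ≡ 0ℤ) → eval x p ≡ 0ℤ
    go []            _        _      = refl
    go ((c , α) ∷ p) (acc rs) p-null = begin
      eval x ((c , α) ∷ p)
        ≡⟨ eval-removeMonomial α ((c , α) ∷ p) ⟩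
      coeff ((c , α) ∷ p) α * monomial x α + eval x rest
        ≡⟨ cong₂ _+_ (cong (_* monomial x α) (p-null α)) (go rest (rs shorter) rest-null) ⟩
      0ℤ * monomial x α + 0ℤ
        ≡⟨ trans (ℤP.+-identityʳ _) (ℤP.*-zeroˡ (monomial x α)) ⟩
      0ℤ
        ∎
      where
      open ≡-Reasoning
      rest : Poly N
      rest = removeMonomial α ((c , α) ∷ p)
      shorter : length rest < length ((c , α) ∷ p)
      shorter with ≡-dec ℕ._≟_ α α
      ... | yes _  = s≤s (length-removeMonomial α p)
      ... | no α≢α = contradiction refl α≢α
      rest-null : ∀ e → coeff rest e ≡ 0ℤ
      rest-null e with ≡-dec ℕ._≟_ α e
      ... | yes refl = coeff-removeMonomial-≡ α ((c , α) ∷ p)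
      ... | no α≢e   = trans (coeff-removeMonomial-≢ ((c , α) ∷ p) α≢e) (p-null e)

  eval-cong : ∀ p q → p ≈P q → eval x p ≡ eval x q
  eval-cong p q p≈q = ℤP.i-j≡0⇒i≡j (eval x p) (eval x q) (begin
    eval x p - eval x q              ≡⟨ cong (_+_ (eval x p)) (eval-negP q) ⟨
    eval x p + eval x (negP q)       ≡⟨ eval-++ p (negP q) ⟨
    eval x (p ++ negP q)             ≡⟨ eval-null (p ++ negP q) difference-null ⟩
    0ℤ                               ∎)
    where
    open ≡-Reasoning
    difference-null : ∀ e → coeff (p ++ negP q) e ≡ 0ℤ
    difference-null e = begin
      coeff (p ++ negP q) e        ≡⟨ coeff-++ p (negP q) e ⟩
      coeff p e + coeff (negP q) e ≡⟨ cong₂ _+_ (p≈q e) (coeff-negP q e) ⟩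
      coeff q e - coeff q e        ≡⟨ ℤP.+-inverseʳ (coeff q e) ⟩
      0ℤ                           ∎

-- Distance ideals

∣-sum : ∀ {m n} {f : Fin n → ℤ} → (∀ j → m ∣ f j) → m ∣ sum f
∣-sum {m} {zero}  m∣f = divides 0ℤ (sym (ℤP.*-zeroˡ m))
∣-sum {m} {suc n} m∣f = ∣m∣n⇒∣m+n (m∣f zero) (∣-sum (m∣f ∘ suc))

nontrivial-by-evaluation : ∀ {N i} (M : Fin N → Fin N → Poly N) (x : Fin N → ℤ) (m : ℤ) →
                           ¬ m ∣ 1ℤ →
                           (∀ (μ : Minor N i) → m ∣ eval x (minorP M μ)) → ¬ TrivialIdeal M i
nontrivial-by-evaluation {N} {i} M x m m∤1 m∣minors (L , L≈1) =
  m∤1 (subst (m ∣_) (trans (eval-cong x (combination L) 1P L≈1) (eval-constP x 1ℤ)) (∣-combination L))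
  where
  combination : List (Poly N × Minor N i) → Poly N
  combination L = sumListP (map (λ { (c , μ) → c *P minorP M μ }) L)
  ∣-combination : ∀ L → m ∣ eval x (combination L)
  ∣-combination []            = divides 0ℤ (sym (ℤP.*-zeroˡ m))
  ∣-combination ((c , μ) ∷ L) =
    subst (m ∣_) (sym (eval-++ x (c *P minorP M μ) _))
      (∣m∣n⇒∣m+n (subst (m ∣_) (sym (eval-*P x c (minorP M μ))) (∣n⇒∣m*n (eval x c) (m∣minors μ)))
                 (∣-combination L))

all-vectors? : ∀ {m} n {P : Vec (Fin m) n → Set} → (∀ v → Dec (P v)) → Dec (∀ v → P v)
all-vectors? zero    P? = Dec.map′ (λ { p [] → p }) (λ ∀P → ∀P []) (P? [])
all-vectors? (suc n) P? = Dec.map′ (λ { ∀P (k ∷ v) → ∀P k v }) (λ ∀P k v → ∀P (k ∷ v))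
                                   (all? λ k → all-vectors? n λ v → P? (k ∷ v))

injective-bounded⇒≤ : ∀ {n k} (f : Fin n → ℕ) → Injective _≡_ _≡_ f →
                      (∀ j → 1 ≤ f j) → (∀ j → f j ≤ k) → n ≤ k
injective-bounded⇒≤ {n} {k} f f-injective 1≤f f≤k = FinP.injective⇒≤ {f = g} λ {i} {j} gi≡gj →
  f-injective (trans (sym (proj₂ (shift i))) (trans (cong (suc ∘ toℕ) gi≡gj) (proj₂ (shift j))))
  where
  shift : ∀ j → Σ (Fin k) λ l → suc (toℕ l) ≡ f j
  shift j with f j | 1≤f j | f≤k j
  ... | suc m | s≤s z≤n | m<k = Fin.fromℕ< m<k , cong suc (FinP.toℕ-fromℕ< m<k)
  g : Fin n → Fin k
  g = proj₁ ∘ shift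

-- The graph Ω

enum : Fin 4 → Block
enum 0F = B₁
enum 1F = A₁
enum 2F = A₂
enum 3F = B₂

index : Block → Fin 4
index B₁ = 0F
index A₁ = 1F
index A₂ = 2F
index B₂ = 3F

enum-index : ∀ b → enum (index b) ≡ b
enum-index B₁ = refl
enum-index A₁ = refl
enum-index A₂ = refl
enum-index B₂ = refl

index-enum : ∀ k → index (enum k) ≡ k
index-enum 0F = refl
index-enum 1F = refl
index-enum 2F = refl
index-enum 3F = refl

-- On the diagonal: the distance between two distinct vertices of the block.
blockDistance : Block → Block → ℕ
blockDistance B₁ B₁ = 1
blockDistance B₁ A₁ = 1
blockDistance B₁ A₂ = 2
blockDistance B₁ B₂ = 3
blockDistance A₁ B₁ = 1
blockDistance A₁ A₁ = 2
blockDistance A₁ A₂ = 1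
blockDistance A₁ B₂ = 2
blockDistance A₂ B₁ = 2
blockDistance A₂ A₁ = 1
blockDistance A₂ A₂ = 2
blockDistance A₂ B₂ = 1
blockDistance B₂ B₁ = 3
blockDistance B₂ A₁ = 2
blockDistance B₂ A₂ = 1
blockDistance B₂ B₂ = 1

ΩPattern : Mat 4 4
ΩPattern k l = + blockDistance (enum k) (enum l)

module ΩPatternSmithForm where
  open import Agda.Builtin.FromNat
  open import Agda.Builtin.FromNeg
  import Data.Nat.Literals as ℕLiterals
  import Data.Integer.Literals as ℤLiterals
  open import Data.Unit using (⊤; tt)

  instance
    unit : ⊤
    unit = tt
    ℕ-number : Number ℕ
    ℕ-number = ℕLiterals.number
    ℤ-number : Number ℤ
    ℤ-number = ℤLiterals.number
    ℤ-negative : Negative ℤ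
    ℤ-negative = ℤLiterals.negative

  -- Obtained by integer row and column reduction of ΩPattern.
  U U⁻¹ V V⁻¹ : Mat 4 4
  U   = matrix (( 1 ∷  0 ∷  0 ∷ 0 ∷ []) ∷
                (-1 ∷  1 ∷  0 ∷ 0 ∷ []) ∷
                ( 3 ∷ -1 ∷ -1 ∷ 0 ∷ []) ∷
                ( 2 ∷ -1 ∷ -2 ∷ 1 ∷ []) ∷ [])
  U⁻¹ = matrix (( 1 ∷  0 ∷  0 ∷ 0 ∷ []) ∷
                ( 1 ∷  1 ∷  0 ∷ 0 ∷ []) ∷
                ( 2 ∷ -1 ∷ -1 ∷ 0 ∷ []) ∷
                ( 3 ∷ -1 ∷ -2 ∷ 1 ∷ []) ∷ [])
  V   = matrix (( 1 ∷ -1 ∷ -3 ∷  2 ∷ []) ∷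
                ( 0 ∷  1 ∷  1 ∷ -1 ∷ []) ∷
                ( 0 ∷  0 ∷  1 ∷ -2 ∷ []) ∷
                ( 0 ∷  0 ∷  0 ∷  1 ∷ []) ∷ [])
  V⁻¹ = matrix (( 1 ∷  1 ∷  2 ∷  3 ∷ []) ∷
                ( 0 ∷  1 ∷ -1 ∷ -1 ∷ []) ∷
                ( 0 ∷  0 ∷  1 ∷  2 ∷ []) ∷
                ( 0 ∷  0 ∷  0 ∷  1 ∷ []) ∷ [])

  smithForm : EquivZ ΩPattern (diagMat target1133)
  smithForm =
    U , V ,
    (U⁻¹ , from-yes (U ⊗ U⁻¹ ≟M idMat) , from-yes (U⁻¹ ⊗ U ≟M idMat)) ,
    (V⁻¹ , from-yes (V ⊗ V⁻¹ ≟M idMat) , from-yes (V⁻¹ ⊗ V ≟M idMat)) ,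
    from-yes ((U ⊗ ΩPattern) ⊗ V ≟M diagMat target1133)

target1133-split : ∀ {K} (i : Fin (4 ℕ.+ K)) → target1133 i ≡ [ target1133 , (λ _ → 0ℤ) ]′ (splitAt 4 i)
target1133-split 0F                        = refl
target1133-split 1F                        = refl
target1133-split 2F                        = refl
target1133-split 3F                        = refl
target1133-split (suc (suc (suc (suc i)))) = refl

target1133-⊕ : ∀ {K} → diagMat {4} target1133 ⊕ 𝟎 {K} {K} ≗M diagMat target1133
target1133-⊕ {K} = begin
  diagMat {4} target1133 ⊕ 𝟎 {K} {K}
    ≈⟨ ⊕-cong {4} {K} ≗M-refl 𝟎≗diagMat ⟩
  diagMat {4} target1133 ⊕ diagMat {K} (λ _ → 0ℤ)
    ≈⟨ diagMat-⊕ {4} {K} target1133 (λ _ → 0ℤ) ⟩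
  diagMat (λ i → [ target1133 , (λ _ → 0ℤ) ]′ (splitAt 4 i))
    ≈⟨ diagMat-cong (sym ∘ target1133-split) ⟩
  diagMat target1133
    ∎
  where open ≗M-Reasoning {4 ℕ.+ K} {4 ℕ.+ K}

classMatrix-smithForm′ : ∀ {N} → 4 ≤ N → (c : Fin N → Fin 4) → StrictlySurjective _≡_ c →
                         EquivZ (classMatrix ΩPattern c) (diagMat target1133)
-- Matching on 4 ≤ N exposes N as 4 + K.
classMatrix-smithForm′ (s≤s (s≤s (s≤s (s≤s (z≤n {K}))))) c c-surjective =
  EquivZ-trans {M = classMatrix ΩPattern c} (classMatrix-equiv ΩPattern c c-surjective) pattern-smithForm
  where
  pattern-smithForm : EquivZ (ΩPattern ⊕ 𝟎 {K} {K}) (diagMat target1133)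
  pattern-smithForm = EquivZ-respʳ {M = ΩPattern ⊕ 𝟎}
    (EquivZ-⊕ {A = ΩPattern} 𝟎 ΩPatternSmithForm.smithForm) target1133-⊕

classMatrix-smithForm : ∀ {N} (c : Fin N → Fin 4) → StrictlySurjective _≡_ c →
                        EquivZ (classMatrix ΩPattern c) (diagMat target1133)
classMatrix-smithForm c c-surjective = classMatrix-smithForm′ (surjective⇒≤ c-surjective) c c-surjective

target1133-isSmithDiagonal : ∀ {n} → 4 ≤ n → IsSmithDiagonal {n} target1133
target1133-isSmithDiagonal 4≤n = 4 , 4≤n , positive , vanishing , dividesNext
  where
  positive : ∀ i → toℕ i < 4 → 0ℤ ℤ.< target1133 i
  positive i i<4 with toℕ i
  ... | 0 = ℤ.+<+ (s≤s z≤n)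
  ... | 1 = ℤ.+<+ (s≤s z≤n)
  ... | 2 = ℤ.+<+ (s≤s z≤n)
  ... | 3 = ℤ.+<+ (s≤s z≤n)
  positive i (s≤s (s≤s (s≤s (s≤s ())))) | suc (suc (suc (suc _)))
  vanishing : ∀ i → 4 ≤ toℕ i → target1133 i ≡ 0ℤ
  vanishing i 4≤i with toℕ i
  vanishing i (s≤s (s≤s (s≤s (s≤s _)))) | suc (suc (suc (suc _))) = refl
  dividesNext : ∀ i j → suc (toℕ i) ≡ toℕ j → suc (toℕ i) < 4 → target1133 i Unsigned.∣ target1133 j
  dividesNext i j i+1≡j i+1<4 with toℕ i | toℕ j
  dividesNext i j refl i+1<4 | 0 | .1 = Unsigned.divides 1 refl
  dividesNext i j refl i+1<4 | 1 | .2 = Unsigned.divides 3 refl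
  dividesNext i j refl i+1<4 | 2 | .3 = Unsigned.divides 1 refl
  dividesNext i j refl (s≤s (s≤s (s≤s (s≤s ())))) | suc (suc (suc _)) | _

three-∣-det₃ : ∀ (r s : Vec (Fin 4) 3) → + 3 ∣ det (λ a b → ΩPattern (lookup r a) (lookup s b))
three-∣-det₃ = from-yes (all-vectors? 3 λ r → all-vectors? 3 λ s →
                           + 3 ∣? det (λ a b → ΩPattern (lookup r a) (lookup s b)))

three-∣-det : ∀ {n} → 3 ≤ n → (β γ : Fin n → Fin 4) → + 3 ∣ det (λ a b → ΩPattern (β a) (γ b))
three-∣-det {1} (s≤s ())
three-∣-det {2} (s≤s (s≤s ()))
three-∣-det {3} _ β γ = subst (+ 3 ∣_)
  (det-cong λ a b → cong₂ ΩPattern (lookup∘tabulate β a) (lookup∘tabulate γ b))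
  (three-∣-det₃ (tabulate β) (tabulate γ))
three-∣-det {suc (suc (suc (suc n)))} _ β γ = ∣-sum λ j →
  ∣n⇒∣m*n (sign j) (∣n⇒∣m*n (ΩPattern (β zero) (γ j))
    (three-∣-det (s≤s (s≤s (s≤s z≤n))) (β ∘ suc) (γ ∘ punchIn j)))

all-blocks? : {P : Block → Set} → (∀ b → Dec (P b)) → Dec (∀ b → P b)
all-blocks? {P} P? = Dec.map′ (λ ∀P b → subst P (enum-index b) (∀P (index b))) (λ ∀P k → ∀P (enum k))
                              (all? (P? ∘ enum))

blockEdge? : ∀ b c → Dec (BlockEdge b c)
blockEdge? B₁ B₁ = yes B₁B₁
blockEdge? B₁ A₁ = yes B₁A₁
blockEdge? B₁ A₂ = no λ ()
blockEdge? B₁ B₂ = no λ ()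
blockEdge? A₁ B₁ = yes A₁B₁
blockEdge? A₁ A₁ = no λ ()
blockEdge? A₁ A₂ = yes A₁A₂
blockEdge? A₁ B₂ = no λ ()
blockEdge? A₂ B₁ = no λ ()
blockEdge? A₂ A₁ = yes A₂A₁
blockEdge? A₂ A₂ = no λ ()
blockEdge? A₂ B₂ = yes A₂B₂
blockEdge? B₂ B₁ = no λ ()
blockEdge? B₂ A₁ = no λ ()
blockEdge? B₂ A₂ = yes B₂A₂
blockEdge? B₂ B₂ = yes B₂B₂

blockDistance-edge : ∀ {b c} → BlockEdge b c → blockDistance b c ≡ 1
blockDistance-edge B₁B₁ = refl
blockDistance-edge B₂B₂ = refl
blockDistance-edge B₁A₁ = refl
blockDistance-edge A₁B₁ = refl
blockDistance-edge A₁A₂ = refl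
blockDistance-edge A₂A₁ = refl
blockDistance-edge A₂B₂ = refl
blockDistance-edge B₂A₂ = refl

blockDistance-triangle : ∀ a {b c} → BlockEdge b c → blockDistance a c ≤ suc (blockDistance a b)
blockDistance-triangle a {b} {c} = from-yes
  (all-blocks? λ a → all-blocks? λ b → all-blocks? λ c →
     blockEdge? b c →-dec blockDistance a c ℕ.≤? suc (blockDistance a b)) a b c

blockWeight≡blockDistance : ∀ b → blockWeight b ≡ + blockDistance b b
blockWeight≡blockDistance B₁ = refl
blockWeight≡blockDistance A₁ = refl
blockWeight≡blockDistance A₂ = refl
blockWeight≡blockDistance B₂ = refl

infixl 5 _▷_
_▷_ : ∀ {N} {Adj : Fin N → Fin N → Set} {u w v k} → Walk Adj u w k → Adj w v → Walk Adj u v (suc k)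
_▷_ = step

module ΩGraph {n₁ m₁ m₂ n₂ : ℕ}
              (1≤n₁ : 1 ≤ n₁) (1≤m₁ : 1 ≤ m₁) (1≤m₂ : 1 ≤ m₂) (1≤n₂ : 1 ≤ n₂) where

  Vertex : Set
  Vertex = Fin (ΩN n₁ m₁ m₂ n₂)

  blockOf : Vertex → Block
  blockOf = block n₁ m₁ m₂ n₂

  Adj : Vertex → Vertex → Set
  Adj = ΩAdj n₁ m₁ m₂ n₂

  representative : Block → Vertex
  representative B₁ = Fin.fromℕ< 1≤n₁ ↑ˡ _
  representative A₁ = n₁ ↑ʳ (Fin.fromℕ< 1≤m₁ ↑ˡ _)
  representative A₂ = n₁ ↑ʳ (m₁ ↑ʳ (Fin.fromℕ< 1≤m₂ ↑ˡ _))
  representative B₂ = n₁ ↑ʳ (m₁ ↑ʳ (m₂ ↑ʳ Fin.fromℕ< 1≤n₂))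

  blockOf-representative : ∀ b → blockOf (representative b) ≡ b
  blockOf-representative B₁ rewrite FinP.splitAt-↑ˡ n₁ (Fin.fromℕ< 1≤n₁) (m₁ ℕ.+ (m₂ ℕ.+ n₂)) = refl
  blockOf-representative A₁
    rewrite FinP.splitAt-↑ʳ n₁ (m₁ ℕ.+ (m₂ ℕ.+ n₂)) (Fin.fromℕ< 1≤m₁ ↑ˡ (m₂ ℕ.+ n₂))
          | FinP.splitAt-↑ˡ m₁ (Fin.fromℕ< 1≤m₁) (m₂ ℕ.+ n₂) = refl
  blockOf-representative A₂
    rewrite FinP.splitAt-↑ʳ n₁ (m₁ ℕ.+ (m₂ ℕ.+ n₂)) (m₁ ↑ʳ (Fin.fromℕ< 1≤m₂ ↑ˡ n₂))
          | FinP.splitAt-↑ʳ m₁ (m₂ ℕ.+ n₂) (Fin.fromℕ< 1≤m₂ ↑ˡ n₂)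
          | FinP.splitAt-↑ˡ m₂ (Fin.fromℕ< 1≤m₂) n₂ = refl
  blockOf-representative B₂
    rewrite FinP.splitAt-↑ʳ n₁ (m₁ ℕ.+ (m₂ ℕ.+ n₂)) (m₁ ↑ʳ (m₂ ↑ʳ Fin.fromℕ< 1≤n₂))
          | FinP.splitAt-↑ʳ m₁ (m₂ ℕ.+ n₂) (m₂ ↑ʳ Fin.fromℕ< 1≤n₂)
          | FinP.splitAt-↑ʳ m₂ n₂ (Fin.fromℕ< 1≤n₂) = refl

  blockDistance-≤-walk : ∀ {u v l} → Walk Adj u v l → u ≢ v → blockDistance (blockOf u) (blockOf v) ≤ l
  blockDistance-≤-walk here u≢u = contradiction refl u≢u
  blockDistance-≤-walk {u} (step {w} W (_ , e)) _ with u ≟ w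
  ... | yes refl = ℕP.≤-trans (ℕP.≤-reflexive (blockDistance-edge e)) (s≤s z≤n)
  ... | no u≢w   = ℕP.≤-trans (blockDistance-triangle (blockOf u) e) (s≤s (blockDistance-≤-walk W u≢w))

  link : ∀ {x y p q} → x ≢ y → blockOf x ≡ p → blockOf y ≡ q → BlockEdge p q → Adj x y
  link x≢y refl refl e = x≢y , e

  cross : ∀ {x y p q} → p ≢ q → blockOf x ≡ p → blockOf y ≡ q → BlockEdge p q → Adj x y
  cross p≢q refl refl e = p≢q ∘ cong blockOf , e

  shortestWalk : ∀ {u v} → u ≢ v → Walk Adj u v (blockDistance (blockOf u) (blockOf v))
  shortestWalk {u} {v} u≢v = walkBetween (blockOf u) (blockOf v) refl refl
    where
    r : ∀ b → blockOf (representative b) ≡ b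
    r = blockOf-representative
    walkBetween : ∀ p q → blockOf u ≡ p → blockOf v ≡ q → Walk Adj u v (blockDistance p q)
    walkBetween B₁ B₁ bu bv = here ▷ link u≢v bu bv B₁B₁
    walkBetween B₁ A₁ bu bv = here ▷ cross (λ ()) bu bv B₁A₁
    walkBetween B₁ A₂ bu bv = here ▷ cross (λ ()) bu (r A₁) B₁A₁ ▷ cross (λ ()) (r A₁) bv A₁A₂
    walkBetween B₁ B₂ bu bv = here ▷ cross (λ ()) bu (r A₁) B₁A₁ ▷ cross (λ ()) (r A₁) (r A₂) A₁A₂
                                 ▷ cross (λ ()) (r A₂) bv A₂B₂
    walkBetween A₁ B₁ bu bv = here ▷ cross (λ ()) bu bv A₁B₁
    walkBetween A₁ A₁ bu bv = here ▷ cross (λ ()) bu (r B₁) A₁B₁ ▷ cross (λ ()) (r B₁) bv B₁A₁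
    walkBetween A₁ A₂ bu bv = here ▷ cross (λ ()) bu bv A₁A₂
    walkBetween A₁ B₂ bu bv = here ▷ cross (λ ()) bu (r A₂) A₁A₂ ▷ cross (λ ()) (r A₂) bv A₂B₂
    walkBetween A₂ B₁ bu bv = here ▷ cross (λ ()) bu (r A₁) A₂A₁ ▷ cross (λ ()) (r A₁) bv A₁B₁
    walkBetween A₂ A₁ bu bv = here ▷ cross (λ ()) bu bv A₂A₁
    walkBetween A₂ A₂ bu bv = here ▷ cross (λ ()) bu (r B₂) A₂B₂ ▷ cross (λ ()) (r B₂) bv B₂A₂
    walkBetween A₂ B₂ bu bv = here ▷ cross (λ ()) bu bv A₂B₂
    walkBetween B₂ B₁ bu bv = here ▷ cross (λ ()) bu (r A₂) B₂A₂ ▷ cross (λ ()) (r A₂) (r A₁) A₂A₁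
                                 ▷ cross (λ ()) (r A₁) bv A₁B₁
    walkBetween B₂ A₁ bu bv = here ▷ cross (λ ()) bu (r A₂) B₂A₂ ▷ cross (λ ()) (r A₂) bv A₂A₁
    walkBetween B₂ A₂ bu bv = here ▷ cross (λ ()) bu bv B₂A₂
    walkBetween B₂ B₂ bu bv = here ▷ link u≢v bu bv B₂B₂

  blockClass : Vertex → Fin 4
  blockClass = index ∘ blockOf

  blockClass-surjective : StrictlySurjective _≡_ blockClass
  blockClass-surjective k =
    representative (enum k) , trans (cong index (blockOf-representative (enum k))) (index-enum k)

  module _ {dist : Vertex → Vertex → ℕ} (isDist : ∀ u v → IsDist Adj u v (dist u v)) where

    dist-refl : ∀ u → dist u u ≡ 0
    dist-refl u = ℕP.n≤0⇒n≡0 (proj₂ (isDist u u) 0 here)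

    dist-≢ : ∀ {u v} → u ≢ v → dist u v ≡ blockDistance (blockOf u) (blockOf v)
    dist-≢ {u} {v} u≢v = ℕP.≤-antisym (proj₂ (isDist u v) _ (shortestWalk u≢v))
                                       (blockDistance-≤-walk (proj₁ (isDist u v)) u≢v)

    DXeval-blockDistance : ∀ u v → DXeval (Ωd n₁ m₁ m₂ n₂) dist u v ≡ + blockDistance (blockOf u) (blockOf v)
    DXeval-blockDistance u v with u ≟ v
    ... | yes refl rewrite dist-refl u = trans (ℤP.+-identityʳ _) (blockWeight≡blockDistance (blockOf u))
    ... | no u≢v   = cong +_ (dist-≢ u≢v)

    DXeval≗classMatrix : DXeval (Ωd n₁ m₁ m₂ n₂) dist ≗M classMatrix ΩPattern blockClass
    DXeval≗classMatrix u v = trans (DXeval-blockDistance u v)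
      (sym (cong₂ (λ b c → + blockDistance b c) (enum-index (blockOf u)) (enum-index (blockOf v))))

    minor-evaluation : ∀ {i} (μ : Minor (ΩN n₁ m₁ m₂ n₂) i) →
                       eval (Ωd n₁ m₁ m₂ n₂) (minorP (DX dist) μ) ≡
                       det (λ a b → ΩPattern (blockClass (Minor.rows μ a)) (blockClass (Minor.cols μ b)))
    minor-evaluation μ =
      trans (eval-detP (Ωd n₁ m₁ m₂ n₂) (λ a b → DX dist (rows a) (cols b))) (det-cong λ a b →
        trans (eval-DX (Ωd n₁ m₁ m₂ n₂) dist (rows a) (cols b)) (DXeval≗classMatrix (rows a) (cols b)))
      where open Minor μ

    nontrivial-≥3 : ∀ {i} → 3 ≤ i → ¬ TrivialIdeal (DX dist) i
    nontrivial-≥3 3≤i =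
      nontrivial-by-evaluation (DX dist) (Ωd n₁ m₁ m₂ n₂) (+ 3) (from-no (+ 3 ∣? 1ℤ)) λ μ →
        subst (+ 3 ∣_) (sym (minor-evaluation μ)) (three-∣-det 3≤i _ _)

    atMostTwoTrivialIdeals : InLambdaZ 2 dist
    atMostTwoTrivialIdeals (f , f-injective , f-trivial) =
      3≰2 (injective-bounded⇒≤ f f-injective (proj₁ ∘ f-trivial) f≤2)
      where
      f≤2 : ∀ j → f j ≤ 2
      f≤2 j = ℕP.≤-pred (ℕP.≰⇒> λ 3≤fj → nontrivial-≥3 3≤fj (proj₂ (f-trivial j)))
      3≰2 : ¬ 3 ≤ 2
      3≰2 (s≤s (s≤s ()))

mainTheorem12 : (n₁ m₁ m₂ n₂ : ℕ) → 1 ≤ n₁ → 1 ≤ m₁ → 1 ≤ m₂ → 1 ≤ n₂ →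
    (dist : Fin (ΩN n₁ m₁ m₂ n₂) → Fin (ΩN n₁ m₁ m₂ n₂) → ℕ) →
    (∀ u v → IsDist (ΩAdj n₁ m₁ m₂ n₂) u v (dist u v)) →
    SmithNormalForm (DXeval (Ωd n₁ m₁ m₂ n₂) dist) target1133 × InLambdaZ 2 dist
mainTheorem12 n₁ m₁ m₂ n₂ 1≤n₁ 1≤m₁ 1≤m₂ 1≤n₂ dist isDist =
  (target1133-isSmithDiagonal (surjective⇒≤ blockClass-surjective) ,
   EquivZ-respˡ (DXeval≗classMatrix isDist) (classMatrix-smithForm blockClass blockClass-surjective)) ,
  atMostTwoTrivialIdeals isDist
  where open ΩGraph 1≤n₁ 1≤m₁ 1≤m₂ 1≤n₂
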